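{- Let $G$ be an equitably 4-colorable graph on $n\ge 2$ vertices and let $l\ge 1$, $m\ge 6$ be integers. Then $\chi_{=}(G\circ^l P_m)\le 4$.
   Context: All graphs are finite, simple and connected. $P_m$ denotes the path on $m$ vertices. A graph is equitably $k$-colorable if its vertex set can be partitioned into $k$ (possibly empty) independent sets $V_1,\dots,V_k$ with $||V_i|-|V_j||\le 1$ for all $i,j$; $\chi_{=}(G)$ is the least $k$ for which $G$ is equitably $k$-colorable. The corona $G\circ H$ is formed from one copy of $G$ and $|V(G)|$ copies of $H$, the $i$-th vertex of $G$ being joined to every vertex of the $i$-th copy of $H$; $G\circ^1 H=G\circ H$ and $G\circ^l H=(G\circ^{l-1}H)\circ H$ for $l\ge 2$. -}

module Defs where

open import Data.Nat using (ℕ; zero; suc; _+_; _*_; _≤_)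
open import Data.Fin using (Fin; splitAt; remQuot; toℕ)
import Data.Fin as F
open import Data.Bool using (Bool; true; false; _∧_)
open import Data.Sum using (_⊎_; inj₁; inj₂)
open import Data.Product using (Σ; _×_; _,_; ∃-syntax; proj₁; proj₂)
open import Data.List using (List; length; filter)
open import Data.List.Base using () renaming (allFin to allFinL)
open import Relation.Nullary using (¬_)
open import Relation.Nullary.Decidable using (⌊_⌋)
open import Relation.Binary.PropositionalEquality using (_≡_)

record Graph : Set where
  constructor mkGraph
  field
    size : ℕ
    adj  : Fin size → Fin size → Bool
open Graph public

IsSimple : Graph → Set
IsSimple G = (∀ i j → adj G i j ≡ adj G j i) × (∀ i → adj G i i ≡ false)

data Reachable (G : Graph) : Fin (size G) → Fin (size G) → Set where
  here : ∀ {i} → Reachable G i i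
  step : ∀ {i j k} → adj G i j ≡ true → Reachable G j k → Reachable G i k

Connected : Graph → Set
Connected G = ∀ i j → Reachable G i j

Path : ℕ → Graph
Path m = mkGraph m (λ i j → ⌊ suc (toℕ i) Data.Nat.≟ toℕ j ⌋ Data.Bool.∨ ⌊ suc (toℕ j) Data.Nat.≟ toℕ i ⌋)
  where import Data.Nat ; import Data.Bool

-- corona G ∘ H: vertices Fin (n + n * h); the first n are the copy of G,
-- vertex (i , a) of Fin n × Fin h (via remQuot) is vertex a of the i-th copy of H.
corona : Graph → Graph → Graph
corona G H = mkGraph (size G + size G * size H) A
  where
  n = size G
  h = size H
  A : Fin (n + n * h) → Fin (n + n * h) → Bool
  A x y with splitAt n x | splitAt n y
  ... | inj₁ i | inj₁ j = adj G i j
  ... | inj₁ i | inj₂ q = ⌊ i F.≟ proj₁ (remQuot {n} h q) ⌋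
  ... | inj₂ p | inj₁ j = ⌊ proj₁ (remQuot {n} h p) F.≟ j ⌋
  ... | inj₂ p | inj₂ q =
        ⌊ proj₁ (remQuot {n} h p) F.≟ proj₁ (remQuot {n} h q) ⌋ ∧ adj H (proj₂ (remQuot {n} h p)) (proj₂ (remQuot {n} h q))


coronaPow : ℕ → Graph → Graph → Graph
coronaPow zero    G H = G
coronaPow (suc l) G H = corona (coronaPow l G H) H

classSize : ∀ {n k} → (Fin n → Fin k) → Fin k → ℕ
classSize {n} c a = length (filter (λ i → c i F.≟ a) (allFinL n))

EquitableColoring : (G : Graph) (k : ℕ) → (Fin (size G) → Fin k) → Set
EquitableColoring G k c =
  (∀ i j → adj G i j ≡ true → ¬ (c i ≡ c j)) ×
  (∀ a b → classSize c a ≤ suc (classSize c b))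

EquitablyColorable : Graph → ℕ → Set
EquitablyColorable G k = ∃[ c ] EquitableColoring G k c

-- χ₌(G) ≤ t : the least k with G equitably k-colourable is at most t,
-- i.e. G is equitably k-colourable for some k ≤ t
EqChromaticAtMost : Graph → ℕ → Set
EqChromaticAtMost G t = ∃[ k ] (k ≤ t × EquitablyColorable G k)

-- Colour the hubs of H ∘ P_m by an equitable 4-colouring of H, whose classes have sizes s or s + 1,
-- and every attached path by alternating colours that avoid the colour of its hub.  Writing
-- m = 4w + 6 + 2r + p, every hub except the last vertex of its colour class gets the two-colouring
-- of its path by a + 2 and a + 3 (a the hub colour); one such path per colour class adds exactly
-- m vertices to every colour.  Hence, in the corona, every colour class has a common multiple of
-- m + 1 vertices plus an affine function of w that depends only on the set E of larger classes of
-- H and on the colourings chosen for the paths at the last hubs (when s = 0 every hub is a last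
-- hub).  For each E a table of such colourings, independent of r and p and found by a computer
-- search, makes these affine functions have equal slopes and constant terms within one of each
-- other; the tables are verified by evaluation.  Iterating the corona step gives the claim for
-- G ∘^l P_m.
module Submission where

open import Defs
open import Data.Bool using (Bool; true; false; if_then_else_; _∧_)
open import Data.Fin as Fin using (Fin; zero; suc; toℕ; _↑ˡ_; _↑ʳ_; splitAt; remQuot; combine)
open import Data.Fin.Patterns using (0F; 1F; 2F; 3F)
import Data.Fin.Properties as Finₚ
open import Data.Fin.Subset using (Subset; inside; outside)
open import Data.List using (length; filter; tabulate)
open import Data.Nat using (ℕ; zero; suc; _+_; _*_; _∸_; _≤_; _≤?_; _<ᵇ_; _≡ᵇ_; _⊓_; pred; z≤n; s≤s)
import Data.Nat as ℕ
import Data.Nat.Properties as ℕₚ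
open import Algebra.Properties.Semiring.Sum ℕₚ.+-*-semiring
  using (sum; sum-syntax; sum-cong-≗; sum-replicate-zero; ∑-distrib-+; ∑-comm; *-distribˡ-sum)
open import Data.Nat.Tactic.RingSolver using (solve-∀)
open import Data.Product using (_×_; _,_; proj₂; uncurry; ∃-syntax)
open import Data.Sum using (inj₁; inj₂; [_,_]′)
open import Data.Vec using (Vec; []; _∷_; lookup)
import Data.Vec as Vec
open import Data.Vec.Properties using (lookup∘tabulate)
open import Function using (_∘_; id)
open import Relation.Binary using (DecidableEquality)
open import Relation.Binary.PropositionalEquality
open import Relation.Nullary using (Dec; yes; no; does; ¬?; _×-dec_; _→-dec_)
open import Relation.Nullary.Decidable using (⌊_⌋; from-yes; map′)
open import Relation.Nullary.Reflects using (ofʸ; ofⁿ)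
open import Relation.Unary using (Pred; Decidable)
open ≡-Reasoning

δ : ∀ {k} → Fin k → Fin k → ℕ
δ x y = if does (x Fin.≟ y) then 1 else 0

count : ∀ {n k} → (Fin n → Fin k) → Fin k → ℕ
count {n} c y = ∑[ i < n ] δ (c i) y

length-filter-tabulate : ∀ {a p n} {A : Set a} {P : Pred A p} (P? : Decidable P) (f : Fin n → A) →
  length (filter P? (tabulate f)) ≡ ∑[ i < n ] (if does (P? (f i)) then 1 else 0)
length-filter-tabulate {n = zero}  P? f = refl
length-filter-tabulate {n = suc n} P? f with does (P? (f zero))
... | true  = cong suc (length-filter-tabulate P? (f ∘ suc))
... | false = length-filter-tabulate P? (f ∘ suc)

classSize≡count : ∀ {n k} (c : Fin n → Fin k) y → classSize c y ≡ count c y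
classSize≡count c y = length-filter-tabulate (λ i → c i Fin.≟ y) id

sum-↑ : ∀ m n (f : Fin (m + n) → ℕ) → sum f ≡ ∑[ i < m ] f (i ↑ˡ n) + ∑[ j < n ] f (m ↑ʳ j)
sum-↑ zero    n f = refl
sum-↑ (suc m) n f = trans (cong (f zero +_) (sum-↑ m n (f ∘ suc))) (sym (ℕₚ.+-assoc (f zero) _ _))

sum-combine : ∀ m n (f : Fin (m * n) → ℕ) → sum f ≡ ∑[ i < m ] ∑[ j < n ] f (combine i j)
sum-combine zero    n f = refl
sum-combine (suc m) n f =
  trans (sum-↑ n (m * n) f) (cong (sum (f ∘ (_↑ˡ m * n)) +_) (sum-combine m n (f ∘ (n ↑ʳ_))))

∑-δ : ∀ {k} (x : Fin k) (f : Fin k → ℕ) → ∑[ a < k ] (δ x a * f a) ≡ f x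
∑-δ {suc k} zero    f =
  trans (cong₂ _+_ (ℕₚ.+-identityʳ (f zero)) (sum-replicate-zero k)) (ℕₚ.+-identityʳ (f zero))
∑-δ         (suc x) f = ∑-δ x (f ∘ suc)

∑-count : ∀ {n k} (c : Fin n → Fin k) → ∑[ a < k ] count c a ≡ n
∑-count {n} {k} c = begin
  ∑[ a < k ] ∑[ i < n ] δ (c i) a ≡⟨ ∑-comm (λ a i → δ (c i) a) ⟩
  ∑[ i < n ] ∑[ a < k ] δ (c i) a ≡⟨ sum-cong-≗ (λ i → ∑-δ′ (c i)) ⟩
  ∑[ i < n ] 1                    ≡⟨ ∑-1 n ⟩
  n                               ∎
  where
  ∑-δ′ : ∀ x → ∑[ a < k ] δ x a ≡ 1
  ∑-δ′ x = trans (sum-cong-≗ λ a → sym (ℕₚ.*-identityʳ (δ x a))) (∑-δ x (λ _ → 1))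
  ∑-1 : ∀ n → ∑[ i < n ] 1 ≡ n
  ∑-1 zero    = refl
  ∑-1 (suc n) = cong suc (∑-1 n)

𝟙[_∈_] : ∀ {k} → Fin k → Subset k → ℕ
𝟙[ a ∈ E ] = if lookup E a then 1 else 0

minimum : ∀ {k} → (Fin (suc k) → ℕ) → ℕ
minimum {zero}  n = n zero
minimum {suc k} n = n zero ⊓ minimum (n ∘ suc)

minimum-≤ : ∀ {k} (n : Fin (suc k) → ℕ) a → minimum n ≤ n a
minimum-≤ {zero}  n zero    = ℕₚ.≤-refl
minimum-≤ {suc k} n zero    = ℕₚ.m⊓n≤m _ _
minimum-≤ {suc k} n (suc a) = ℕₚ.≤-trans (ℕₚ.m⊓n≤n _ _) (minimum-≤ (n ∘ suc) a)

minimum-greatest : ∀ {k x} (n : Fin (suc k) → ℕ) → (∀ a → x ≤ n a) → x ≤ minimum n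
minimum-greatest {zero}  n x≤ = x≤ zero
minimum-greatest {suc k} n x≤ = ℕₚ.⊓-glb (x≤ zero) (minimum-greatest (n ∘ suc) (x≤ ∘ suc))

twoValued : ∀ {k} (n : Fin (suc k) → ℕ) → (∀ a b → n a ≤ suc (n b)) →
            ∃[ s ] ∃[ E ] ∀ a → n a ≡ s + 𝟙[ a ∈ E ]
twoValued n close = s , Vec.tabulate larger , sizes
  where
  s = minimum n
  larger = λ a → s <ᵇ n a
  ≤s+1 : ∀ a → n a ≤ suc s
  ≤s+1 a with ℕₚ.pred-cancel-≤ (minimum-greatest n (λ b → ℕₚ.pred-mono-≤ (close a b)))
  ... | inj₂ na≤s+1 = na≤s+1
  sizes : ∀ a → n a ≡ s + 𝟙[ a ∈ Vec.tabulate larger ]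
  sizes a rewrite lookup∘tabulate larger a with s <ᵇ n a | ℕₚ.<ᵇ-reflects-< s (n a)
  ... | true  | ofʸ s<na = trans (ℕₚ.≤-antisym (≤s+1 a) s<na) (ℕₚ.+-comm 1 s)
  ... | false | ofⁿ s≮na = trans (ℕₚ.≤-antisym (ℕₚ.≮⇒≥ s≮na) (minimum-≤ n a)) (sym (ℕₚ.+-identityʳ s))

witness : ∀ {a} {A : Set a} (a? : Dec A) → ⌊ a? ⌋ ≡ true → A
witness (yes a) _ = a

∧-true : ∀ {a b} → a ∧ b ≡ true → a ≡ true × b ≡ true
∧-true {true} b≡true = refl , b≡true

Proper : (G : Graph) {k : ℕ} → (Fin (size G) → Fin k) → Set
Proper G c = ∀ i j → adj G i j ≡ true → c i ≢ c j

module _ {H F : Graph} {k : ℕ} where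

  coronaColouring : (Fin (size H) → Fin k) → (Fin (size H) → Fin (size F) → Fin k) →
                    Fin (size (corona H F)) → Fin k
  coronaColouring c d x = [ c , uncurry d ∘ remQuot (size F) ]′ (splitAt (size H) x)

  coronaColouring-proper : ∀ {c d} → Proper H c → (∀ i → Proper F (d i)) → (∀ i u → d i u ≢ c i) →
                           Proper (corona H F) (coronaColouring c d)
  coronaColouring-proper {c} {d} c-proper d-proper d-avoids x y x~y
    with splitAt (size H) x | splitAt (size H) y
  ... | inj₁ i | inj₁ j  = c-proper i j x~y
  ... | inj₁ i | inj₂ q  = λ ci≡ → d-avoids _ _ (trans (sym ci≡) (cong c (witness (i Fin.≟ _) x~y)))
  ... | inj₂ q | inj₁ j  = λ ≡cj → d-avoids _ _ (trans ≡cj (cong c (sym (witness (_ Fin.≟ j) x~y))))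
  ... | inj₂ q | inj₂ q′ with ∧-true x~y
  ...   | same-copy , adjacent =
          subst (λ i → d i _ ≢ d _ _) (sym (witness (_ Fin.≟ _) same-copy)) (d-proper _ _ _ adjacent)

  count-coronaColouring : ∀ c d y →
    count (coronaColouring c d) y ≡ count c y + ∑[ i < size H ] count (d i) y
  count-coronaColouring c d y = begin
    count col y
      ≡⟨ sum-↑ n (n * h) (λ x → δ (col x) y) ⟩
    ∑[ i < n ] δ (col (i ↑ˡ n * h)) y + ∑[ q < n * h ] δ (col (n ↑ʳ q)) y
      ≡⟨ cong₂ _+_ (sum-cong-≗ λ i → cong (λ z → δ z y) (col-hub i))
                   (sum-combine n h (λ q → δ (col (n ↑ʳ q)) y)) ⟩
    count c y + ∑[ i < n ] ∑[ u < h ] δ (col (n ↑ʳ combine i u)) y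
      ≡⟨ cong (count c y +_) (sum-cong-≗ λ i → sum-cong-≗ λ u → cong (λ z → δ z y) (col-copy i u)) ⟩
    count c y + ∑[ i < n ] count (d i) y ∎
    where
    n = size H
    h = size F
    col = coronaColouring c d
    col-hub : ∀ i → col (i ↑ˡ n * h) ≡ c i
    col-hub i = cong [ c , uncurry d ∘ remQuot h ]′ (Finₚ.splitAt-↑ˡ n i (n * h))
    col-copy : ∀ i u → col (n ↑ʳ combine i u) ≡ d i u
    col-copy i u = trans (cong [ c , uncurry d ∘ remQuot h ]′ (Finₚ.splitAt-↑ʳ n (n * h) (combine i u)))
                         (cong (uncurry d) (Finₚ.remQuot-combine i u))

Path-proper : ∀ {k m} (f : ℕ → Fin k) → (∀ j → f j ≢ f (suc j)) → Proper (Path m) (f ∘ toℕ)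
Path-proper f next u v u~v with suc (toℕ u) ℕ.≟ toℕ v | suc (toℕ v) ℕ.≟ toℕ u
... | yes u+1≡v | _         = λ fu≡fv → next (toℕ u) (trans fu≡fv (cong f (sym u+1≡v)))
... | no _      | yes v+1≡u = λ fu≡fv → next (toℕ v) (trans (sym fu≡fv) (cong f (sym v+1≡u)))
Path-proper f next u v () | no _ | no _

-- The sequence b c b c … b c b d b d b d …, with K copies of c.
zigzag : ∀ {k} → Fin k → Fin k → Fin k → ℕ → ℕ → Fin k
zigzag b c d K       zero          = b
zigzag b c d K       (suc (suc j)) = zigzag b c d (pred K) j
zigzag b c d zero    (suc zero)    = d
zigzag b c d (suc K) (suc zero)    = c

module _ {k} {b c d : Fin k} where

  zigzag-step : b ≢ c → b ≢ d → ∀ K j → zigzag b c d K j ≢ zigzag b c d K (suc j)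
  zigzag-step b≢c b≢d zero    zero          = b≢d
  zigzag-step b≢c b≢d (suc K) zero          = b≢c
  zigzag-step b≢c b≢d zero    (suc zero)    = b≢d ∘ sym
  zigzag-step b≢c b≢d (suc K) (suc zero)    = b≢c ∘ sym
  zigzag-step b≢c b≢d K       (suc (suc j)) = zigzag-step b≢c b≢d (pred K) j

  zigzag-avoids : ∀ {a} → b ≢ a → c ≢ a → d ≢ a → ∀ K j → zigzag b c d K j ≢ a
  zigzag-avoids b≢a c≢a d≢a K       zero          = b≢a
  zigzag-avoids b≢a c≢a d≢a zero    (suc zero)    = d≢a
  zigzag-avoids b≢a c≢a d≢a (suc K) (suc zero)    = c≢a
  zigzag-avoids b≢a c≢a d≢a K       (suc (suc j)) = zigzag-avoids b≢a c≢a d≢a (pred K) j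

  count-zigzag : ∀ K L p → p ≤ 1 → ∀ y →
    count {2 * (K + L) + p} (zigzag b c d K ∘ toℕ) y ≡ (K + L + p) * δ b y + K * δ c y + L * δ d y
  count-zigzag zero zero .0 z≤n y = refl
  count-zigzag zero zero .1 (s≤s z≤n) y = single (δ b y) (δ c y) (δ d y)
    where
    single : ∀ B C D → B + 0 ≡ (0 + 0 + 1) * B + 0 * C + 0 * D
    single = solve-∀
  count-zigzag zero (suc L) p p≤1 y = begin
    count {2 * suc L + p} (zig 0) y                     ≡⟨ cong (λ n → count {n} (zig 0) y) (two-more L p) ⟩
    δ b y + (δ d y + count {2 * L + p} (zig 0) y)       ≡⟨ cong (λ t → δ b y + (δ d y + t)) (count-zigzag 0 L p p≤1 y) ⟩
    δ b y + (δ d y + ((L + p) * δ b y + 0 + L * δ d y)) ≡⟨ regroup L p (δ b y) (δ d y) ⟩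
    (suc L + p) * δ b y + 0 + suc L * δ d y             ∎
    where
    zig : ∀ {n} → ℕ → Fin n → Fin k
    zig K = zigzag b c d K ∘ toℕ
    two-more : ∀ L p → 2 * suc L + p ≡ suc (suc (2 * L + p))
    two-more = solve-∀
    regroup : ∀ L p B D → B + (D + ((L + p) * B + 0 + L * D)) ≡ (suc L + p) * B + 0 + suc L * D
    regroup = solve-∀
  count-zigzag (suc K) L p p≤1 y = begin
    count {2 * (suc K + L) + p} (zig (suc K)) y          ≡⟨ cong (λ n → count {n} (zig (suc K)) y) (two-more K L p) ⟩
    δ b y + (δ c y + count {2 * (K + L) + p} (zig K) y)  ≡⟨ cong (λ t → δ b y + (δ c y + t)) (count-zigzag K L p p≤1 y) ⟩
    δ b y + (δ c y + ((K + L + p) * δ b y + K * δ c y + L * δ d y)) ≡⟨ regroup K L p (δ b y) (δ c y) (δ d y) ⟩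
    (suc K + L + p) * δ b y + suc K * δ c y + L * δ d y   ∎
    where
    zig : ∀ {n} → ℕ → Fin n → Fin k
    zig K = zigzag b c d K ∘ toℕ
    two-more : ∀ K L p → 2 * (suc K + L) + p ≡ suc (suc (2 * (K + L) + p))
    two-more = solve-∀
    regroup : ∀ K L p B C D →
              B + (C + ((K + L + p) * B + K * C + L * D)) ≡ (suc K + L + p) * B + suc K * C + L * D
    regroup = solve-∀

isLast : ∀ {n k} → (Fin n → Fin k) → Fin n → Bool
isLast c zero    = count (c ∘ suc) (c zero) ≡ᵇ 0
isLast c (suc i) = isLast (c ∘ suc) i

classTotal : ℕ → (Bool → ℕ) → ℕ
classTotal zero    g = 0
classTotal (suc n) g = g true + n * g false

classTotal-suc : ∀ n g → classTotal (suc n) g ≡ g (n ≡ᵇ 0) + classTotal n g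
classTotal-suc zero    g = refl
classTotal-suc (suc n) g = swap (g true) (g false) (n * g false)
  where
  swap : ∀ x y z → x + (y + z) ≡ y + (x + z)
  swap = solve-∀

classTotal-δ+ : ∀ {k} (x a : Fin k) n g → classTotal (δ x a + n) g ≡ δ x a * g (n ≡ᵇ 0) + classTotal n g
classTotal-δ+ x a n g with does (x Fin.≟ a)
... | false = refl
... | true  = trans (classTotal-suc n g) (cong (_+ classTotal n g) (sym (ℕₚ.+-identityʳ _)))

classTotal-𝟙 : ∀ {k} (a : Fin k) E g → classTotal 𝟙[ a ∈ E ] g ≡ 𝟙[ a ∈ E ] * g true
classTotal-𝟙 a E g with lookup E a
... | true  = refl
... | false = refl

sum-byClass : ∀ {n k} (c : Fin n → Fin k) (g : Fin k → Bool → ℕ) →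
  ∑[ i < n ] g (c i) (isLast c i) ≡ ∑[ a < k ] classTotal (count c a) (g a)
sum-byClass {zero}  {k} c g = sym (sum-replicate-zero k)
sum-byClass {suc n} {k} c g = begin
  g (c zero) (isLast c zero) + ∑[ i < n ] g (c (suc i)) (isLast (c ∘ suc) i)
    ≡⟨ cong₂ _+_ (sym (∑-δ (c zero) (λ a → g a (rest a ≡ᵇ 0)))) (sum-byClass (c ∘ suc) g) ⟩
  ∑[ a < k ] (δ (c zero) a * g a (rest a ≡ᵇ 0)) + ∑[ a < k ] classTotal (rest a) (g a)
    ≡⟨ sym (∑-distrib-+ (λ a → δ (c zero) a * g a (rest a ≡ᵇ 0)) (λ a → classTotal (rest a) (g a))) ⟩
  ∑[ a < k ] (δ (c zero) a * g a (rest a ≡ᵇ 0) + classTotal (rest a) (g a))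
    ≡⟨ sum-cong-≗ (λ a → sym (classTotal-δ+ (c zero) a (rest a) (g a))) ⟩
  ∑[ a < k ] classTotal (count c a) (g a) ∎
  where
  rest = count (c ∘ suc)

-- Affine functions of w

record Affine : Set where
  constructor _w+_
  field
    slope offset : ℕ
open Affine

infix  8 _w+_
infixl 6 _⊕_ _⊖_
infixr 7 _·_

⟦_⟧ : Affine → ℕ → ℕ
⟦ α w+ β ⟧ w = α * w + β

_⊕_ : Affine → Affine → Affine
(α w+ β) ⊕ (α′ w+ β′) = (α + α′) w+ (β + β′)

_⊖_ : Affine → Affine → Affine
(α w+ β) ⊖ (α′ w+ β′) = (α ∸ α′) w+ (β ∸ β′)

_·_ : ℕ → Affine → Affine
n · (α w+ β) = (n * α) w+ (n * β)

⨁ : ∀ {n} → (Fin n → Affine) → Affine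
⨁ {zero}  f = 0 w+ 0
⨁ {suc n} f = f zero ⊕ ⨁ (f ∘ suc)

_≟ᴬ_ : DecidableEquality Affine
(α w+ β) ≟ᴬ (α′ w+ β′) =
  map′ (λ (α≡ , β≡) → cong₂ _w+_ α≡ β≡) (λ { refl → refl , refl }) (α ℕₚ.≟ α′ ×-dec β ℕₚ.≟ β′)

⟦⊕⟧ : ∀ A B w → ⟦ A ⊕ B ⟧ w ≡ ⟦ A ⟧ w + ⟦ B ⟧ w
⟦⊕⟧ (α w+ β) (α′ w+ β′) w = distrib α β α′ β′ w
  where
  distrib : ∀ α β α′ β′ w → (α + α′) * w + (β + β′) ≡ α * w + β + (α′ * w + β′)
  distrib = solve-∀

⟦·⟧ : ∀ n A w → ⟦ n · A ⟧ w ≡ n * ⟦ A ⟧ w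
⟦·⟧ n (α w+ β) w = distrib n α β w
  where
  distrib : ∀ n α β w → n * α * w + n * β ≡ n * (α * w + β)
  distrib = solve-∀

⟦⊖⟧ : ∀ A B w → slope B ≤ slope A → offset B ≤ offset A → ⟦ B ⟧ w + ⟦ A ⊖ B ⟧ w ≡ ⟦ A ⟧ w
⟦⊖⟧ (α w+ β) (α′ w+ β′) w α′≤α β′≤β = begin
  α′ * w + β′ + ((α ∸ α′) * w + (β ∸ β′))   ≡⟨ regroup (α′ * w) β′ ((α ∸ α′) * w) (β ∸ β′) ⟩
  (α′ * w + (α ∸ α′) * w) + (β′ + (β ∸ β′)) ≡⟨ cong₂ _+_ slopes (ℕₚ.m+[n∸m]≡n β′≤β) ⟩
  α * w + β                                 ∎
  where
  regroup : ∀ a b c d → a + b + (c + d) ≡ (a + c) + (b + d)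
  regroup = solve-∀
  slopes = trans (sym (ℕₚ.*-distribʳ-+ w α′ (α ∸ α′))) (cong (_* w) (ℕₚ.m+[n∸m]≡n α′≤α))

⟦⨁⟧ : ∀ {n} (f : Fin n → Affine) w → ⟦ ⨁ f ⟧ w ≡ ∑[ i < n ] ⟦ f i ⟧ w
⟦⨁⟧ {zero}  f w = refl
⟦⨁⟧ {suc n} f w = trans (⟦⊕⟧ (f zero) (⨁ (f ∘ suc)) w) (cong (⟦ f zero ⟧ w +_) (⟦⨁⟧ (f ∘ suc) w))

⟦⟧-suc : ∀ A w → ⟦ A ⟧ (suc w) ≡ slope A + ⟦ A ⟧ w
⟦⟧-suc (α w+ β) w = trans (cong (_+ β) (ℕₚ.*-suc α w)) (ℕₚ.+-assoc α (α * w) β)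

≤-suc-+ : ∀ k {x y} → x ≤ suc y → k + x ≤ suc (k + y)
≤-suc-+ k x≤y+1 = ℕₚ.≤-trans (ℕₚ.+-monoʳ-≤ k x≤y+1) (ℕₚ.≤-reflexive (ℕₚ.+-suc k _))

Balanced : ∀ {k} → (Fin k → Affine) → Set
Balanced R = ∀ y y′ → slope (R y) ≡ slope (R y′) × offset (R y) ≤ suc (offset (R y′))

balanced? : ∀ {k} (R : Fin k → Affine) → Dec (Balanced R)
balanced? R = Finₚ.all? λ y → Finₚ.all? λ y′ →
  slope (R y) ℕₚ.≟ slope (R y′) ×-dec offset (R y) ≤? suc (offset (R y′))

Balanced-⟦⟧ : ∀ {k} {R : Fin k → Affine} → Balanced R → ∀ w y y′ → ⟦ R y ⟧ w ≤ suc (⟦ R y′ ⟧ w)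
Balanced-⟦⟧ {R = R} balanced w y y′ with balanced y y′
... | α≡α′ , β≤β′+1 = subst (λ α → α * w + offset (R y) ≤ suc (⟦ R y′ ⟧ w)) (sym α≡α′)
                            (≤-suc-+ (slope (R y′) * w) β≤β′+1)

-- Paths of length m = 4w + 6 + 2r + p

halfLength : Fin 2 → Affine
halfLength r = 2 w+ (3 + toℕ r)

pathLength : Fin 2 → Fin 2 → Affine
pathLength r p = 2 · halfLength r ⊕ 0 w+ toℕ p

⟦pathLength⟧ : ∀ r p w → ⟦ pathLength r p ⟧ w ≡ 2 * ⟦ halfLength r ⟧ w + toℕ p
⟦pathLength⟧ r p w =
  trans (⟦⊕⟧ (2 · halfLength r) (0 w+ toℕ p) w) (cong (_+ toℕ p) (⟦·⟧ 2 (halfLength r) w))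

pathLength-onto : ∀ j → ∃[ w ] ∃[ r ] ∃[ p ] 6 + j ≡ ⟦ pathLength r p ⟧ w
pathLength-onto 0 = 0 , 0F , 0F , refl
pathLength-onto 1 = 0 , 0F , 1F , refl
pathLength-onto 2 = 0 , 1F , 0F , refl
pathLength-onto 3 = 0 , 1F , 1F , refl
pathLength-onto (suc (suc (suc (suc j)))) with pathLength-onto j
... | w , r , p , eq = suc w , r , p , trans (cong (4 +_) eq) (sym (⟦⟧-suc (pathLength r p) w))

record Block : Set where
  constructor block
  field
    major minor₁ minor₂ : Fin 4
    switch : Affine

twoColour : Fin 4 → Fin 4 → Block
twoColour b d = block b d d (0 w+ 0)

blockColouring : ℕ → Block → ℕ → Fin 4
blockColouring w (block b c d K) = zigzag b c d (⟦ K ⟧ w)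

-- The bounds on the switch make it at most the half length for every r and w.
Fits : Fin 4 → Block → Set
Fits a (block b c d K) = b ≢ a × c ≢ a × d ≢ a × b ≢ c × b ≢ d × slope K ≤ 2 × offset K ≤ 3

fits? : ∀ a B → Dec (Fits a B)
fits? a (block b c d K) =
  ¬? (b Fin.≟ a) ×-dec ¬? (c Fin.≟ a) ×-dec ¬? (d Fin.≟ a) ×-dec ¬? (b Fin.≟ c) ×-dec ¬? (b Fin.≟ d) ×-dec
  slope K ≤? 2 ×-dec offset K ≤? 3

blockColouring-step : ∀ {a} B → Fits a B → ∀ w j → blockColouring w B j ≢ blockColouring w B (suc j)
blockColouring-step (block b c d K) (_ , _ , _ , b≢c , b≢d , _) w = zigzag-step b≢c b≢d (⟦ K ⟧ w)

blockColouring-avoids : ∀ {a} B → Fits a B → ∀ w j → blockColouring w B j ≢ a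
blockColouring-avoids (block b c d K) (b≢a , c≢a , d≢a , _) w = zigzag-avoids b≢a c≢a d≢a (⟦ K ⟧ w)

blockCount : Fin 2 → Fin 2 → Block → Fin 4 → Affine
blockCount r p (block b c d K) y =
  δ b y · (halfLength r ⊕ 0 w+ toℕ p) ⊕ δ c y · K ⊕ δ d y · (halfLength r ⊖ K)

count-blockColouring : ∀ {a} B → Fits a B → ∀ w r p y →
  count {⟦ pathLength r p ⟧ w} (blockColouring w B ∘ toℕ) y ≡ ⟦ blockCount r p B y ⟧ w
count-blockColouring (block b c d K) (_ , _ , _ , _ , _ , α≤2 , β≤3) w r p y = begin
  count {⟦ pathLength r p ⟧ w} (zig ∘ toℕ) y
    ≡⟨ cong (λ n → count {n} (zig ∘ toℕ) y) length≡ ⟩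
  count {2 * (⟦ K ⟧ w + L) + toℕ p} (zig ∘ toℕ) y
    ≡⟨ count-zigzag (⟦ K ⟧ w) L (toℕ p) (Finₚ.toℕ≤pred[n] p) y ⟩
  (⟦ K ⟧ w + L + toℕ p) * δ b y + ⟦ K ⟧ w * δ c y + L * δ d y
    ≡⟨ cong (λ h → (h + toℕ p) * δ b y + ⟦ K ⟧ w * δ c y + L * δ d y) K+L≡h ⟩
  (h + toℕ p) * δ b y + ⟦ K ⟧ w * δ c y + L * δ d y
    ≡⟨ cong₂ _+_ (cong₂ _+_ (ℕₚ.*-comm (h + toℕ p) (δ b y)) (ℕₚ.*-comm (⟦ K ⟧ w) (δ c y)))
                 (ℕₚ.*-comm L (δ d y)) ⟩
  δ b y * (h + toℕ p) + δ c y * ⟦ K ⟧ w + δ d y * L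
    ≡⟨ sym ⟦blockCount⟧ ⟩
  ⟦ blockCount r p (block b c d K) y ⟧ w ∎
  where
  zig = zigzag b c d (⟦ K ⟧ w)
  h = ⟦ halfLength r ⟧ w
  L = ⟦ halfLength r ⊖ K ⟧ w
  K+L≡h : ⟦ K ⟧ w + L ≡ h
  K+L≡h = ⟦⊖⟧ (halfLength r) K w α≤2 (ℕₚ.≤-trans β≤3 (ℕₚ.m≤m+n 3 (toℕ r)))
  length≡ : ⟦ pathLength r p ⟧ w ≡ 2 * (⟦ K ⟧ w + L) + toℕ p
  length≡ = trans (⟦pathLength⟧ r p w) (cong (λ h → 2 * h + toℕ p) (sym K+L≡h))
  B = δ b y · (halfLength r ⊕ 0 w+ toℕ p)
  C = δ c y · K
  D = δ d y · (halfLength r ⊖ K)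
  ⟦blockCount⟧ : ⟦ B ⊕ C ⊕ D ⟧ w ≡ δ b y * (h + toℕ p) + δ c y * ⟦ K ⟧ w + δ d y * L
  ⟦blockCount⟧ = begin
    ⟦ B ⊕ C ⊕ D ⟧ w           ≡⟨ trans (⟦⊕⟧ (B ⊕ C) D w) (cong (_+ ⟦ D ⟧ w) (⟦⊕⟧ B C w)) ⟩
    ⟦ B ⟧ w + ⟦ C ⟧ w + ⟦ D ⟧ w
      ≡⟨ cong₂ _+_ (cong₂ _+_ (trans (⟦·⟧ (δ b y) (halfLength r ⊕ 0 w+ toℕ p) w)
                                     (cong (δ b y *_) (⟦⊕⟧ (halfLength r) (0 w+ toℕ p) w)))
                              (⟦·⟧ (δ c y) K w))
                   (⟦·⟧ (δ d y) (halfLength r ⊖ K) w) ⟩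
    δ b y * (h + toℕ p) + δ c y * ⟦ K ⟧ w + δ d y * L ∎

normal : Fin 4 → Block
normal 0F = twoColour 2F 3F
normal 1F = twoColour 3F 0F
normal 2F = twoColour 0F 1F
normal 3F = twoColour 1F 2F

normal-fits : ∀ a → Fits a (normal a)
normal-fits = from-yes (Finₚ.all? λ a → fits? a (normal a))

normal-fair : ∀ r p y → ⨁ (λ a → blockCount r p (normal a) y) ≡ pathLength r p
normal-fair = from-yes (Finₚ.all? λ r → Finₚ.all? λ p → Finₚ.all? λ y →
  ⨁ (λ a → blockCount r p (normal a) y) ≟ᴬ pathLength r p)

module CoronaPathColouring
  {H : Graph} {c : Fin (size H) → Fin 4} (c-proper : Proper H c)
  (last : Fin 4 → Block) (last-fits : ∀ a → Fits a (last a))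
  (w : ℕ) (r p : Fin 2) where

  m : ℕ
  m = ⟦ pathLength r p ⟧ w

  choose : Fin 4 → Bool → Block
  choose a true  = last a
  choose a false = normal a

  blockOf : Fin (size H) → Block
  blockOf i = choose (c i) (isLast c i)

  blockOf-fits : ∀ i → Fits (c i) (blockOf i)
  blockOf-fits i with isLast c i
  ... | true  = last-fits (c i)
  ... | false = normal-fits (c i)

  pathColouring : Fin (size H) → Fin m → Fin 4
  pathColouring i = blockColouring w (blockOf i) ∘ toℕ

  colouring : Fin (size (corona H (Path m))) → Fin 4
  colouring = coronaColouring {H = H} {F = Path m} c pathColouring

  colouring-proper : Proper (corona H (Path m)) colouring
  colouring-proper = coronaColouring-proper c-proper
    (λ i → Path-proper (blockColouring w (blockOf i)) (blockColouring-step (blockOf i) (blockOf-fits i) w))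
    (λ i u → blockColouring-avoids (blockOf i) (blockOf-fits i) w (toℕ u))

  count-colouring : ∀ y → count colouring y ≡
    count c y + ∑[ a < 4 ] classTotal (count c a) (λ ℓ → ⟦ blockCount r p (choose a ℓ) y ⟧ w)
  count-colouring y = begin
    count colouring y
      ≡⟨ count-coronaColouring {H = H} {F = Path m} c pathColouring y ⟩
    count c y + ∑[ i < size H ] count (pathColouring i) y
      ≡⟨ cong (count c y +_) (sum-cong-≗ λ i → count-blockColouring (blockOf i) (blockOf-fits i) w r p y) ⟩
    count c y + ∑[ i < size H ] ⟦ blockCount r p (blockOf i) y ⟧ w
      ≡⟨ cong (count c y +_) (sum-byClass c (λ a ℓ → ⟦ blockCount r p (choose a ℓ) y ⟧ w)) ⟩
    count c y + ∑[ a < 4 ] classTotal (count c a) (λ ℓ → ⟦ blockCount r p (choose a ℓ) y ⟧ w) ∎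

-- Certificates

-- Entry a of a row is the block at the last vertex of colour a, for E the set of larger classes.
-- In thinLast the entries for colours outside E, and the rows with fewer than two elements in E,
-- are never used.
thinLast : Subset 4 → Vec Block 4
thinLast (outside ∷ outside ∷ inside  ∷ inside  ∷ []) = normal 0F ∷ normal 1F ∷ twoColour 0F 3F ∷ twoColour 1F 2F ∷ []
thinLast (outside ∷ inside  ∷ outside ∷ inside  ∷ []) = normal 0F ∷ twoColour 0F 3F ∷ normal 2F ∷ twoColour 2F 1F ∷ []
thinLast (outside ∷ inside  ∷ inside  ∷ outside ∷ []) = normal 0F ∷ twoColour 0F 2F ∷ twoColour 3F 1F ∷ normal 3F ∷ []
thinLast (outside ∷ inside  ∷ inside  ∷ inside  ∷ []) = normal 0F ∷ block 2F 3F 0F (1 w+ 1) ∷ twoColour 3F 1F ∷ block 0F 1F 2F (1 w+ 2) ∷ []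
thinLast (inside  ∷ outside ∷ outside ∷ inside  ∷ []) = twoColour 1F 3F ∷ normal 1F ∷ normal 2F ∷ twoColour 2F 0F ∷ []
thinLast (inside  ∷ outside ∷ inside  ∷ outside ∷ []) = twoColour 1F 2F ∷ normal 1F ∷ twoColour 3F 0F ∷ normal 3F ∷ []
thinLast (inside  ∷ outside ∷ inside  ∷ inside  ∷ []) = block 2F 3F 1F (1 w+ 1) ∷ normal 1F ∷ twoColour 3F 0F ∷ block 1F 0F 2F (1 w+ 2) ∷ []
thinLast (inside  ∷ inside  ∷ outside ∷ outside ∷ []) = twoColour 2F 1F ∷ twoColour 3F 0F ∷ normal 2F ∷ normal 3F ∷ []
thinLast (inside  ∷ inside  ∷ outside ∷ inside  ∷ []) = block 1F 3F 2F (1 w+ 1) ∷ twoColour 3F 0F ∷ normal 2F ∷ block 2F 0F 1F (1 w+ 2) ∷ []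
thinLast (inside  ∷ inside  ∷ inside  ∷ outside ∷ []) = block 1F 3F 2F (1 w+ 2) ∷ twoColour 2F 0F ∷ block 3F 0F 1F (1 w+ 2) ∷ normal 3F ∷ []
thinLast (inside  ∷ inside  ∷ inside  ∷ inside  ∷ []) = twoColour 1F 2F ∷ twoColour 0F 3F ∷ twoColour 3F 0F ∷ twoColour 2F 1F ∷ []
thinLast _ = Vec.tabulate normal

thickLast : Subset 4 → Vec Block 4
thickLast (outside ∷ outside ∷ outside ∷ outside ∷ []) = twoColour 1F 2F ∷ twoColour 0F 3F ∷ twoColour 3F 0F ∷ twoColour 2F 1F ∷ []
thickLast (outside ∷ outside ∷ outside ∷ inside  ∷ []) = twoColour 1F 3F ∷ block 2F 3F 0F (1 w+ 1) ∷ twoColour 3F 0F ∷ block 0F 2F 1F (1 w+ 2) ∷ []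
thickLast (outside ∷ outside ∷ inside  ∷ outside ∷ []) = block 2F 1F 3F (1 w+ 2) ∷ twoColour 3F 2F ∷ twoColour 3F 0F ∷ block 1F 2F 0F (1 w+ 1) ∷ []
thickLast (outside ∷ outside ∷ inside  ∷ inside  ∷ []) = twoColour 1F 3F ∷ twoColour 2F 3F ∷ twoColour 3F 0F ∷ twoColour 0F 2F ∷ []
thickLast (outside ∷ inside  ∷ outside ∷ outside ∷ []) = twoColour 1F 2F ∷ block 0F 2F 3F (1 w+ 2) ∷ twoColour 3F 1F ∷ block 2F 1F 0F (1 w+ 1) ∷ []
thickLast (outside ∷ inside  ∷ outside ∷ inside  ∷ []) = twoColour 2F 1F ∷ twoColour 0F 3F ∷ twoColour 0F 3F ∷ twoColour 2F 1F ∷ []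
thickLast (outside ∷ inside  ∷ inside  ∷ outside ∷ []) = twoColour 1F 2F ∷ twoColour 2F 3F ∷ twoColour 3F 1F ∷ twoColour 0F 2F ∷ []
thickLast (outside ∷ inside  ∷ inside  ∷ inside  ∷ []) = twoColour 2F 3F ∷ block 2F 3F 0F (1 w+ 1) ∷ twoColour 3F 1F ∷ block 0F 1F 2F (1 w+ 2) ∷ []
thickLast (inside  ∷ outside ∷ outside ∷ outside ∷ []) = twoColour 2F 1F ∷ twoColour 3F 0F ∷ block 1F 3F 0F (1 w+ 2) ∷ block 0F 1F 2F (1 w+ 2) ∷ []
thickLast (inside  ∷ outside ∷ outside ∷ inside  ∷ []) = twoColour 1F 3F ∷ twoColour 2F 0F ∷ twoColour 3F 0F ∷ twoColour 0F 1F ∷ []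
thickLast (inside  ∷ outside ∷ inside  ∷ outside ∷ []) = twoColour 1F 2F ∷ twoColour 3F 0F ∷ twoColour 3F 0F ∷ twoColour 1F 2F ∷ []
thickLast (inside  ∷ outside ∷ inside  ∷ inside  ∷ []) = block 2F 3F 1F (1 w+ 1) ∷ twoColour 3F 0F ∷ twoColour 3F 0F ∷ block 1F 0F 2F (1 w+ 2) ∷ []
thickLast (inside  ∷ inside  ∷ outside ∷ outside ∷ []) = twoColour 1F 2F ∷ twoColour 2F 0F ∷ twoColour 3F 1F ∷ twoColour 0F 1F ∷ []
thickLast (inside  ∷ inside  ∷ outside ∷ inside  ∷ []) = twoColour 2F 1F ∷ block 0F 3F 2F (1 w+ 1) ∷ block 3F 0F 1F (1 w+ 2) ∷ twoColour 1F 0F ∷ []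
thickLast (inside  ∷ inside  ∷ inside  ∷ outside ∷ []) = block 1F 3F 2F (1 w+ 2) ∷ twoColour 2F 0F ∷ block 3F 0F 1F (1 w+ 2) ∷ twoColour 1F 2F ∷ []
thickLast (inside  ∷ inside  ∷ inside  ∷ inside  ∷ []) = twoColour 1F 2F ∷ twoColour 0F 3F ∷ twoColour 3F 0F ∷ twoColour 2F 1F ∷ []

thinResidual : Subset 4 → Fin 2 → Fin 2 → Fin 4 → Affine
thinResidual E r p y = 0 w+ 𝟙[ y ∈ E ] ⊕ ⨁ λ a → 𝟙[ a ∈ E ] · blockCount r p (lookup (thinLast E) a) y

thickResidual : Subset 4 → Fin 2 → Fin 2 → Fin 4 → Affine
thickResidual E r p y =
  0 w+ suc 𝟙[ y ∈ E ] ⊕ ⨁ λ a →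
    blockCount r p (lookup (thickLast E) a) y ⊕ 𝟙[ a ∈ E ] · blockCount r p (normal a) y

record Certificate (last : Vec Block 4) (residual : Fin 2 → Fin 2 → Fin 4 → Affine) : Set where
  field
    fits     : ∀ a → Fits a (lookup last a)
    balanced : ∀ r p → Balanced (residual r p)

certificate? : ∀ last residual → Dec (Certificate last residual)
certificate? last residual =
  map′ (λ (f , b) → record { fits = f ; balanced = b }) (λ C → Certificate.fits C , Certificate.balanced C)
       (Finₚ.all? (λ a → fits? a (lookup last a)) ×-dec
        Finₚ.all? λ r → Finₚ.all? λ p → balanced? (residual r p))

allSubsets? : ∀ {n p} {P : Pred (Subset n) p} → Decidable P → Dec (∀ E → P E)
allSubsets? {zero}  P? = map′ (λ P[] → λ { [] → P[] }) (λ ∀P → ∀P []) (P? [])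
allSubsets? {suc n} P? =
  map′ (λ (Pin , Pout) → λ { (inside ∷ E) → Pin E ; (outside ∷ E) → Pout E })
       (λ ∀P → ∀P ∘ (inside ∷_) , ∀P ∘ (outside ∷_))
       (allSubsets? (P? ∘ (inside ∷_)) ×-dec allSubsets? (P? ∘ (outside ∷_)))

thin-certificate : ∀ E → 2 ≤ ∑[ a < 4 ] 𝟙[ a ∈ E ] → Certificate (thinLast E) (thinResidual E)
thin-certificate = from-yes (allSubsets? λ E →
  2 ≤? ∑[ a < 4 ] 𝟙[ a ∈ E ] →-dec certificate? (thinLast E) (thinResidual E))

thick-certificate : ∀ E → Certificate (thickLast E) (thickResidual E)
thick-certificate = from-yes (allSubsets? λ E → certificate? (thickLast E) (thickResidual E))

⟦thinResidual⟧ : ∀ E r p y w → ⟦ thinResidual E r p y ⟧ w ≡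
  𝟙[ y ∈ E ] + ∑[ a < 4 ] (𝟙[ a ∈ E ] * ⟦ blockCount r p (lookup (thinLast E) a) y ⟧ w)
⟦thinResidual⟧ E r p y w =
  trans (⟦⊕⟧ (0 w+ 𝟙[ y ∈ E ]) (⨁ f) w)
        (cong (𝟙[ y ∈ E ] +_) (trans (⟦⨁⟧ f w) (sum-cong-≗ λ a → ⟦·⟧ 𝟙[ a ∈ E ] (L a) w)))
  where
  L = λ a → blockCount r p (lookup (thinLast E) a) y
  f = λ a → 𝟙[ a ∈ E ] · L a

⟦thickResidual⟧ : ∀ E r p y w → ⟦ thickResidual E r p y ⟧ w ≡
  suc 𝟙[ y ∈ E ] + ∑[ a < 4 ] (⟦ blockCount r p (lookup (thickLast E) a) y ⟧ w +
                               𝟙[ a ∈ E ] * ⟦ blockCount r p (normal a) y ⟧ w)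
⟦thickResidual⟧ E r p y w =
  trans (⟦⊕⟧ (0 w+ suc 𝟙[ y ∈ E ]) (⨁ f) w)
        (cong (suc 𝟙[ y ∈ E ] +_) (trans (⟦⨁⟧ f w) (sum-cong-≗ λ a →
          trans (⟦⊕⟧ (L a) (𝟙[ a ∈ E ] · N a) w) (cong (⟦ L a ⟧ w +_) (⟦·⟧ 𝟙[ a ∈ E ] (N a) w)))))
  where
  L = λ a → blockCount r p (lookup (thickLast E) a) y
  N = λ a → blockCount r p (normal a) y
  f = λ a → L a ⊕ 𝟙[ a ∈ E ] · N a

thin-equitable : ∀ {H} {c : Fin (size H) → Fin 4} → Proper H c → ∀ E → (∀ a → count c a ≡ 𝟙[ a ∈ E ]) →
  2 ≤ size H → ∀ w r p → EquitablyColorable (corona H (Path (⟦ pathLength r p ⟧ w))) 4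
thin-equitable {c = c} c-proper E sizes 2≤n w r p = colouring , colouring-proper , balanced
  where
  open Certificate (thin-certificate E (subst (2 ≤_) (trans (sym (∑-count c)) (sum-cong-≗ sizes)) 2≤n))
    renaming (balanced to residual-balanced)
  open CoronaPathColouring c-proper (lookup (thinLast E)) fits w r p
  classSize≡residual : ∀ y → classSize colouring y ≡ ⟦ thinResidual E r p y ⟧ w
  classSize≡residual y = begin
    classSize colouring y ≡⟨ classSize≡count colouring y ⟩
    count colouring y     ≡⟨ count-colouring y ⟩
    count c y + ∑[ a < 4 ] classTotal (count c a) (G a)
      ≡⟨ cong₂ _+_ (sizes y) (sum-cong-≗ λ a →
           trans (cong (λ n → classTotal n (G a)) (sizes a)) (classTotal-𝟙 a E (G a))) ⟩
    𝟙[ y ∈ E ] + ∑[ a < 4 ] (𝟙[ a ∈ E ] * G a true) ≡⟨ sym (⟦thinResidual⟧ E r p y w) ⟩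
    ⟦ thinResidual E r p y ⟧ w ∎
    where
    G = λ a ℓ → ⟦ blockCount r p (choose a ℓ) y ⟧ w
  balanced : ∀ y y′ → classSize colouring y ≤ suc (classSize colouring y′)
  balanced y y′ = subst₂ (λ u v → u ≤ suc v) (sym (classSize≡residual y)) (sym (classSize≡residual y′))
                         (Balanced-⟦⟧ (residual-balanced r p) w y y′)

∑-split : ∀ {k} s (x e n : Fin k → ℕ) →
  ∑[ a < k ] (x a + (s + e a) * n a) ≡ s * ∑[ a < k ] n a + ∑[ a < k ] (x a + e a * n a)
∑-split {k} s x e n = begin
  ∑[ a < k ] (x a + (s + e a) * n a)                  ≡⟨ sum-cong-≗ (λ a → regroup (x a) s (e a) (n a)) ⟩
  ∑[ a < k ] (s * n a + (x a + e a * n a))            ≡⟨ ∑-distrib-+ (λ a → s * n a) (λ a → x a + e a * n a) ⟩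
  ∑[ a < k ] (s * n a) + ∑[ a < k ] (x a + e a * n a) ≡⟨ cong (_+ _) (sym (*-distribˡ-sum s n)) ⟩
  s * ∑[ a < k ] n a + ∑[ a < k ] (x a + e a * n a)   ∎
  where
  regroup : ∀ x s e n → x + (s + e) * n ≡ s * n + (x + e * n)
  regroup = solve-∀

thick-equitable : ∀ {H} {c : Fin (size H) → Fin 4} → Proper H c → ∀ s E →
  (∀ a → count c a ≡ suc (s + 𝟙[ a ∈ E ])) →
  ∀ w r p → EquitablyColorable (corona H (Path (⟦ pathLength r p ⟧ w))) 4
thick-equitable {c = c} c-proper s E sizes w r p = colouring , colouring-proper , balanced
  where
  open Certificate (thick-certificate E) renaming (balanced to residual-balanced)
  open CoronaPathColouring c-proper (lookup (thickLast E)) fits w r p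
  classSize≡residual : ∀ y → classSize colouring y ≡ s * suc m + ⟦ thickResidual E r p y ⟧ w
  classSize≡residual y = begin
    classSize colouring y ≡⟨ classSize≡count colouring y ⟩
    count colouring y     ≡⟨ count-colouring y ⟩
    count c y + ∑[ a < 4 ] classTotal (count c a) (G a)
      ≡⟨ cong₂ _+_ (sizes y) (sum-cong-≗ λ a → cong (λ n → classTotal n (G a)) (sizes a)) ⟩
    suc (s + 𝟙[ y ∈ E ]) + ∑[ a < 4 ] (G a true + (s + 𝟙[ a ∈ E ]) * G a false)
      ≡⟨ cong (suc (s + 𝟙[ y ∈ E ]) +_) (∑-split s (λ a → G a true) (λ a → 𝟙[ a ∈ E ]) (λ a → G a false)) ⟩
    suc (s + 𝟙[ y ∈ E ]) + (s * ∑[ a < 4 ] G a false + R)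
      ≡⟨ cong (λ t → suc (s + 𝟙[ y ∈ E ]) + (s * t + R)) normal-total ⟩
    suc (s + 𝟙[ y ∈ E ]) + (s * m + R) ≡⟨ regroup s 𝟙[ y ∈ E ] m R ⟩
    s * suc m + (suc 𝟙[ y ∈ E ] + R)   ≡⟨ cong (s * suc m +_) (sym (⟦thickResidual⟧ E r p y w)) ⟩
    s * suc m + ⟦ thickResidual E r p y ⟧ w ∎
    where
    G = λ a ℓ → ⟦ blockCount r p (choose a ℓ) y ⟧ w
    R = ∑[ a < 4 ] (G a true + 𝟙[ a ∈ E ] * G a false)
    normal-total : ∑[ a < 4 ] G a false ≡ m
    normal-total = trans (sym (⟦⨁⟧ (λ a → blockCount r p (normal a) y) w))
                         (cong (λ A → ⟦ A ⟧ w) (normal-fair r p y))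
    regroup : ∀ s e m R → suc (s + e) + (s * m + R) ≡ s * suc m + (suc e + R)
    regroup = solve-∀
  balanced : ∀ y y′ → classSize colouring y ≤ suc (classSize colouring y′)
  balanced y y′ = subst₂ (λ u v → u ≤ suc v) (sym (classSize≡residual y)) (sym (classSize≡residual y′))
                         (≤-suc-+ (s * suc m) (Balanced-⟦⟧ (residual-balanced r p) w y y′))

corona-Path-equitable : ∀ {H m} → 2 ≤ size H → EquitablyColorable H 4 → 6 ≤ m →
                        EquitablyColorable (corona H (Path m)) 4
corona-Path-equitable {H} {m} 2≤n (c , c-proper , c-balanced) 6≤m
  with twoValued (count c) (λ a b → subst₂ (λ u v → u ≤ suc v)
                                             (classSize≡count c a) (classSize≡count c b) (c-balanced a b))
     | pathLength-onto (m ∸ 6)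
... | s , E , sizes | w , r , p , m≡ =
  subst (λ m → EquitablyColorable (corona H (Path m)) 4) (trans (sym m≡) (ℕₚ.m+[n∸m]≡n 6≤m)) (regime s sizes)
  where
  regime : ∀ s → (∀ a → count c a ≡ s + 𝟙[ a ∈ E ]) →
           EquitablyColorable (corona H (Path (⟦ pathLength r p ⟧ w))) 4
  regime zero    sizes = thin-equitable c-proper E sizes 2≤n w r p
  regime (suc s) sizes = thick-equitable c-proper s E sizes w r p

coronaPow-Path-equitable : ∀ {G m} → 2 ≤ size G → EquitablyColorable G 4 → 6 ≤ m → ∀ l →
  2 ≤ size (coronaPow l G (Path m)) × EquitablyColorable (coronaPow l G (Path m)) 4
coronaPow-Path-equitable 2≤n χ 6≤m zero    = 2≤n , χ
coronaPow-Path-equitable 2≤n χ 6≤m (suc l) with coronaPow-Path-equitable 2≤n χ 6≤m l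
... | 2≤n′ , χ′ = ℕₚ.≤-trans 2≤n′ (ℕₚ.m≤m+n _ _) , corona-Path-equitable 2≤n′ χ′ 6≤m

corollary3 : (G : Graph) → IsSimple G → Connected G → 2 ≤ size G →
             EquitablyColorable G 4 →
             (l m : ℕ) → 1 ≤ l → 6 ≤ m →
             EqChromaticAtMost (coronaPow l G (Path m)) 4
corollary3 G _ _ 2≤n χ l m _ 6≤m = 4 , ℕₚ.≤-refl , proj₂ (coronaPow-Path-equitable 2≤n χ 6≤m l)
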